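{- Let $p$ be a prime and $t>0$ an integer. (1) If $p\equiv\pm1\pmod 5$, then $H_{p,2t}\equiv 2H_{4(t-1),2(t-1)}\equiv 2F_{2t-1}^2\pmod p$. (2) If $p\equiv \pm2\pmod 5$, then $H_{p,2t+1}\equiv 2H_{4t,2t}-1\equiv 2F_{2t+1}^2-1\pmod p$.
   Context: $F_n$ denotes the Fibonacci numbers ($F_0=0$, $F_1=1$, $F_{n}=F_{n-1}+F_{n-2}$), extended to negative indices by $F_{ -n}=(-1)^{n-1}F_n$. For integers $r,k$, $H_{r,k}=F_{k+1}F_{r-k+2}-F_kF_{r-k+1}=F_{k-1}F_{r-k+2}+F_kF_{r-k}$. -}

module Defs where

open import Data.Nat as ℕ using (ℕ; zero; suc)
open import Data.Integer using (ℤ; +_; -[1+_]; _+_; _-_; _*_; -_)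
open import Data.Integer.Divisibility using (_∣_)

fibℕ : ℕ → ℕ
fibℕ zero = zero
fibℕ (suc zero) = suc zero
fibℕ (suc (suc n)) = fibℕ (suc n) ℕ.+ fibℕ n

sgn : ℕ → ℤ
sgn zero = + 1
sgn (suc n) = - sgn n

-- Fibonacci extended to ℤ by F_{-n} = (-1)^{n-1} F_n
F : ℤ → ℤ
F (+ n) = + fibℕ n
F -[1+ n ] = sgn n * + fibℕ (suc n)

H : ℤ → ℤ → ℤ
H r k = F (k + + 1) * F (r - k + + 2) - F k * F (r - k + + 1)

_≅_[mod_] : ℤ → ℤ → ℤ → Set
a ≅ b [mod m ] = m ∣ (a - b)
infix 4 _≅_[mod_]

-- Work in ℤ[C₅] = ℤ[X]/(X⁵ - 1) with φ = 1 + X + X⁴ and N = 1 + X + X² + X³ + X⁴. There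
-- φ² = φ + 1 + N and φ N = 3 N, so φⁿ = Fₙ φ + Fₙ₋₁ + cₙ N. Modulo a prime p, Frobenius gives
-- φᵖ ≡ 1 + Xᵖ + X⁻ᵖ, which only depends on p mod 5; comparing coefficients, (Fₚ, Fₚ₋₁) ≡ (1, 0)
-- if p ≡ ±1 and (-1, 1) if p ≡ ±2 (mod 5).
-- For fixed k, r ↦ H_{r,k} satisfies the Fibonacci recurrence, hence H_{p,k} = Fₚ H_{1,k} + Fₚ₋₁ H_{0,k},
-- that is H_{p,k} ≡ H_{1,k}, respectively H_{p,k} ≡ H_{0,k} - H_{1,k} = -H_{-1,k}. The addition formula
-- gives H_{r,k} = F_{r+2} - 2 F_k F_{r-k+1}, so H_{1,2t} = 2 + 2 F_{2t} F_{2t-2} = 2 F_{2t-1}² by Cassini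
-- and -H_{-1,2t+1} = 2 F_{2t+1} F_{-2t-1} - 1 = 2 F_{2t+1}² - 1, while H_{2j,j} = F_{j+1}² directly.

module Submission where

open import Algebra.Bundles using (CommutativeSemiring)
open import Data.Empty using (⊥-elim)
open import Data.Fin.Base using (Fin; zero; suc; toℕ; fromℕ; inject₁)
open import Data.Fin.Patterns using (0F; 1F; 2F; 3F; 4F)
open import Data.Fin.Properties using (toℕ<n; toℕ-fromℕ; toℕ-inject₁)
open import Data.Nat.Base as ℕ using (ℕ; zero; suc; NonZero; _≥_; _<_; _%_; s≤s; z≤n)
open import Data.Nat.Combinatorics using (_C_; nCn≡1; nC1≡n; nCk+nC[k+1]≡[n+1]C[k+1])
import Data.Nat.Divisibility as ℕ
open import Data.Nat.DivMod using (_/_; m≡m%n+[m/n]*n)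
open import Data.Nat.Primality using (Prime; euclidsLemma)
import Data.Nat.Properties as ℕ
import Data.Nat.Tactic.RingSolver as ℕ-Solver
open import Data.Product using (_×_; _,_; proj₁; proj₂; ∃)
open import Data.Sum using (_⊎_; inj₁; inj₂)
open import Function.Base using (_∘_)
open import Level using (0ℓ)
open import Relation.Binary.Structures using (IsEquivalence)
import Relation.Binary.PropositionalEquality as ≡
open ≡ using (_≡_; _≗_; refl; sym; trans; cong; cong₂; subst; module ≡-Reasoning)

-- Binomial coefficients and the Frobenius map

[1+k]*[1+n]C[1+k]≡[1+n]*nCk : ∀ n k → suc k ℕ.* (suc n C suc k) ≡ suc n ℕ.* (n C k)
[1+k]*[1+n]C[1+k]≡[1+n]*nCk zero    zero    = refl
[1+k]*[1+n]C[1+k]≡[1+n]*nCk zero    (suc k) = ℕ.*-zeroʳ (suc (suc k))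
[1+k]*[1+n]C[1+k]≡[1+n]*nCk (suc n) zero    =
  trans (ℕ.*-identityˡ _) (trans (nC1≡n (suc (suc n))) (sym (ℕ.*-identityʳ _)))
[1+k]*[1+n]C[1+k]≡[1+n]*nCk (suc n) (suc k) = begin
  (2 ℕ.+ k) ℕ.* (suc (suc n) C suc (suc k))
    ≡⟨ cong ((2 ℕ.+ k) ℕ.*_) (nCk+nC[k+1]≡[n+1]C[k+1] (suc n) (suc k)) ⟨
  (2 ℕ.+ k) ℕ.* (A ℕ.+ B)
    ≡⟨ regroup k A B ⟩
  A ℕ.+ suc k ℕ.* A ℕ.+ (2 ℕ.+ k) ℕ.* B
    ≡⟨ cong₂ (λ x y → A ℕ.+ x ℕ.+ y) ([1+k]*[1+n]C[1+k]≡[1+n]*nCk n k)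
                                     ([1+k]*[1+n]C[1+k]≡[1+n]*nCk n (suc k)) ⟩
  A ℕ.+ suc n ℕ.* (n C k) ℕ.+ suc n ℕ.* (n C suc k)
    ≡⟨ ℕ.+-assoc A _ _ ⟩
  A ℕ.+ (suc n ℕ.* (n C k) ℕ.+ suc n ℕ.* (n C suc k))
    ≡⟨ cong (A ℕ.+_) (ℕ.*-distribˡ-+ (suc n) (n C k) (n C suc k)) ⟨
  A ℕ.+ suc n ℕ.* (n C k ℕ.+ n C suc k)
    ≡⟨ cong (λ x → A ℕ.+ suc n ℕ.* x) (nCk+nC[k+1]≡[n+1]C[k+1] n k) ⟩
  A ℕ.+ suc n ℕ.* A
    ≡⟨⟩
  (2 ℕ.+ n) ℕ.* A ∎
  where
  open ≡-Reasoning
  A = suc n C suc k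
  B = suc n C suc (suc k)
  regroup : ∀ k A B → (2 ℕ.+ k) ℕ.* (A ℕ.+ B) ≡ A ℕ.+ suc k ℕ.* A ℕ.+ (2 ℕ.+ k) ℕ.* B
  regroup = ℕ-Solver.solve-∀

prime∣pCk : ∀ {p k} → Prime p → 0 < k → k < p → p ℕ.∣ p C k
prime∣pCk {suc n} {suc k} p-prime _ k<p
  with euclidsLemma (suc k) (suc n C suc k) p-prime
         (subst (suc n ℕ.∣_) (sym ([1+k]*[1+n]C[1+k]≡[1+n]*nCk n k)) (ℕ.m∣m*n (n C k)))
... | inj₁ p∣k    = ⊥-elim (ℕ.<⇒≱ k<p (ℕ.∣⇒≤ p∣k))
... | inj₂ p∣pCk = p∣pCk

module Frobenius {c ℓ} (R : CommutativeSemiring c ℓ) where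

  open CommutativeSemiring R hiding (zero) renaming (refl to ≈-refl; sym to ≈-sym; trans to ≈-trans)
  open import Algebra.Properties.Semiring.Mult semiring public using () renaming (_×_ to _×ₙ_)
  open import Algebra.Properties.Semiring.Mult semiring using (×-congʳ; ×-assocˡ; ×-homo-1)
  open import Algebra.Properties.Semiring.Exp semiring public using (_^_)
  open import Algebra.Properties.Semiring.Exp semiring using (^-congˡ; ^-homo-*; ^-assocʳ)
  open import Algebra.Properties.Monoid.Sum +-monoid
    using (sum; sum-cong-≋; sum-replicate; sum-replicate-zero; sum-init-last)
  import Algebra.Properties.CommutativeSemiring.Binomial R as Binomial
  open import Relation.Binary.Reasoning.Setoid setoid

  HasCharacteristic : ℕ → Set _
  HasCharacteristic p = ∀ x → p ×ₙ x ≈ 0#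

  ×-zeroʳ : ∀ n → n ×ₙ 0# ≈ 0#
  ×-zeroʳ n = ≈-trans (≈-sym (sum-replicate n)) (sum-replicate-zero n)

  1#^n≈1# : ∀ n → 1# ^ n ≈ 1#
  1#^n≈1# zero    = ≈-refl
  1#^n≈1# (suc n) = ≈-trans (*-identityˡ _) (1#^n≈1# n)

  ^-periodic : ∀ {k} .{{_ : NonZero k}} {x} → x ^ k ≈ 1# → ∀ n → x ^ n ≈ x ^ (n % k)
  ^-periodic {k} {x} x^k≈1 n = begin
    x ^ n                            ≡⟨ cong (x ^_) (m≡m%n+[m/n]*n n k) ⟩
    x ^ (n % k ℕ.+ n / k ℕ.* k)      ≈⟨ ^-homo-* x (n % k) _ ⟩
    x ^ (n % k) * x ^ (n / k ℕ.* k)  ≡⟨ cong (λ e → x ^ (n % k) * x ^ e) (ℕ.*-comm (n / k) k) ⟩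
    x ^ (n % k) * x ^ (k ℕ.* (n / k)) ≈⟨ *-congˡ (^-assocʳ x k (n / k)) ⟨
    x ^ (n % k) * (x ^ k) ^ (n / k)  ≈⟨ *-congˡ (≈-trans (^-congˡ (n / k) x^k≈1) (1#^n≈1# (n / k))) ⟩
    x ^ (n % k) * 1#                 ≈⟨ *-identityʳ _ ⟩
    x ^ (n % k)                      ∎

  ∣⇒×≈0 : ∀ {p n} → HasCharacteristic p → ∀ x → p ℕ.∣ n → n ×ₙ x ≈ 0#
  ∣⇒×≈0 {p} char x (ℕ.divides q refl) = begin
    (q ℕ.* p) ×ₙ x ≈⟨ ×-assocˡ x q p ⟨
    q ×ₙ (p ×ₙ x)  ≈⟨ ×-congʳ q (char x) ⟩
    q ×ₙ 0#        ≈⟨ ×-zeroʳ q ⟩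
    0#             ∎

  frobenius : ∀ {p} → Prime p → HasCharacteristic p → ∀ x y → (x + y) ^ p ≈ x ^ p + y ^ p
  frobenius {suc n} p-prime char x y = begin
    (x + y) ^ suc n                                             ≈⟨ Binomial.theorem (suc n) x y ⟩
    term zero + sum (tail term)                                 ≈⟨ +-congˡ (sum-init-last (tail term)) ⟩
    term zero + (sum (init (tail term)) + term (fromℕ (suc n))) ≈⟨ +-cong first (+-cong middle last) ⟩
    y ^ suc n + (0# + x ^ suc n)                                ≈⟨ +-congˡ (+-identityˡ _) ⟩
    y ^ suc n + x ^ suc n                                       ≈⟨ +-comm _ _ ⟩
    x ^ suc n + y ^ suc n                                       ∎
    where
    open import Data.Vec.Functional using (tail; init)
    term = Binomial.binomialTerm x y (suc n)
    first : term zero ≈ y ^ suc n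
    first = ≈-trans (×-homo-1 _) (*-identityˡ _)
    last : term (fromℕ (suc n)) ≈ x ^ suc n
    last rewrite toℕ-fromℕ n | nCn≡1 (suc n) | ℕ.n∸n≡0 n = ≈-trans (×-homo-1 _) (*-identityʳ _)
    middle : sum (init (tail term)) ≈ 0#
    middle = ≈-trans (sum-cong-≋ vanishing) (sum-replicate-zero n)
      where
      vanishing : ∀ i → term (suc (inject₁ i)) ≈ 0#
      vanishing i = ∣⇒×≈0 char _ (prime∣pCk p-prime (s≤s z≤n)
        (s≤s (subst (ℕ._< n) (sym (toℕ-inject₁ i)) (toℕ<n i))))

-- Imported only here, since these operators would clash with those of the semiring in Frobenius.
open import Data.Integer.Base using (ℤ; +_; -[1+_]; _+_; _-_; _*_; -_)
import Data.Integer.Divisibility.Signed as ℤˢ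
import Data.Integer.Properties as ℤ
open import Data.Integer.Tactic.RingSolver using (solve-∀)
open import Defs

-- Congruences of integers

-- A record, unlike the unfolding relation _≅_[mod_], lets Agda infer a, b and m.
record _≡_[mod_] (a b m : ℤ) : Set where
  constructor by-divisibility
  field divides : m ℤˢ.∣ (a - b)
open _≡_[mod_]
infix 4 _≡_[mod_]

module _ {m : ℤ} where

  private
    transport : ∀ {x a b} → x ≡ a - b → m ℤˢ.∣ x → a ≡ b [mod m ]
    transport eq m∣x = by-divisibility (subst (m ℤˢ.∣_) eq m∣x)

  ≡⇒≡-mod : ∀ {a b} → a ≡ b → a ≡ b [mod m ]
  ≡⇒≡-mod {a} refl = transport (sym (ℤ.+-inverseʳ a)) (ℤˢ.divides (+ 0) refl)

  mod-refl : ∀ {a} → a ≡ a [mod m ]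
  mod-refl = ≡⇒≡-mod refl

  mod-sym : ∀ {a b} → a ≡ b [mod m ] → b ≡ a [mod m ]
  mod-sym {a} {b} a≡b = transport (eq a b) (ℤˢ.∣m⇒∣-m (divides a≡b))
    where
    eq : ∀ a b → - (a - b) ≡ b - a
    eq = solve-∀

  mod-trans : ∀ {a b c} → a ≡ b [mod m ] → b ≡ c [mod m ] → a ≡ c [mod m ]
  mod-trans {a} {b} {c} a≡b b≡c =
    transport (ℤ.+-minus-telescope a b c) (ℤˢ.∣m∣n⇒∣m+n (divides a≡b) (divides b≡c))

  +-cong-mod : ∀ {a a′ b b′} → a ≡ a′ [mod m ] → b ≡ b′ [mod m ] → a + b ≡ a′ + b′ [mod m ]
  +-cong-mod {a} {a′} {b} {b′} a≡a′ b≡b′ =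
    transport (eq a a′ b b′) (ℤˢ.∣m∣n⇒∣m+n (divides a≡a′) (divides b≡b′))
    where
    eq : ∀ a a′ b b′ → (a - a′) + (b - b′) ≡ (a + b) - (a′ + b′)
    eq = solve-∀

  *-cong-mod : ∀ {a a′ b b′} → a ≡ a′ [mod m ] → b ≡ b′ [mod m ] → a * b ≡ a′ * b′ [mod m ]
  *-cong-mod {a} {a′} {b} {b′} a≡a′ b≡b′ = transport (eq a a′ b b′)
    (ℤˢ.∣m∣n⇒∣m+n (ℤˢ.∣m⇒∣m*n b (divides a≡a′)) (ℤˢ.∣n⇒∣m*n a′ (divides b≡b′)))
    where
    eq : ∀ a a′ b b′ → (a - a′) * b + a′ * (b - b′) ≡ a * b - a′ * b′
    eq = solve-∀

  -‿cong-mod : ∀ {a b} → a ≡ b [mod m ] → - a ≡ - b [mod m ]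
  -‿cong-mod {a} {b} a≡b = transport (eq a b) (ℤˢ.∣m⇒∣-m (divides a≡b))
    where
    eq : ∀ a b → - (a - b) ≡ - a - - b
    eq = solve-∀

  ∣⇒≡0-mod : ∀ {a} → m ℤˢ.∣ a → a ≡ + 0 [mod m ]
  ∣⇒≡0-mod {a} = transport (sym (ℤ.+-identityʳ a))

≡-mod⇒≅ : ∀ {a b m} → a ≡ b [mod m ] → a ≅ b [mod m ]
≡-mod⇒≅ = ℤˢ.∣⇒∣ᵤ ∘ divides

-- Fibonacci-like sequences and the numbers H_{r,k}

record FibonacciLike (f : ℤ → ℤ) : Set where
  constructor fibonacciLike
  field recurrence : ∀ n → f (n + + 2) ≡ f (n + + 1) + f n
open FibonacciLike

F-recurrence : ∀ n → F (n + + 2) ≡ F (n + + 1) + F n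
F-recurrence (+ k) =
  trans (cong (λ j → + fibℕ j) (ℕ.+-comm k 2)) (cong (λ j → + fibℕ j + + fibℕ k) (ℕ.+-comm 1 k))
F-recurrence -[1+ 0 ] = refl
F-recurrence -[1+ 1 ] = refl
F-recurrence -[1+ suc (suc k) ] = lemma (sgn k) (+ fibℕ (suc k)) (+ fibℕ k)
  where
  lemma : ∀ s a b → s * a ≡ (- s) * (a + b) + (- - s) * (a + b + a)
  lemma = solve-∀

F-fibonacciLike : FibonacciLike F
F-fibonacciLike = fibonacciLike F-recurrence

fibonacciLike-shift : ∀ {f} c → FibonacciLike f → FibonacciLike (λ n → f (n + c))
fibonacciLike-shift {f} c rec = fibonacciLike λ n → begin
  f (n + + 2 + c)              ≡⟨ cong f (swap n (+ 2) c) ⟩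
  f (n + c + + 2)              ≡⟨ recurrence rec (n + c) ⟩
  f (n + c + + 1) + f (n + c)  ≡⟨ cong (λ i → f i + f (n + c)) (swap n c (+ 1)) ⟩
  f (n + + 1 + c) + f (n + c)  ∎
  where
  open ≡-Reasoning
  swap : ∀ a b c → a + b + c ≡ a + c + b
  swap = solve-∀

fibonacciLike-* : ∀ {f} a → FibonacciLike f → FibonacciLike (λ n → a * f n)
fibonacciLike-* {f} a rec = fibonacciLike λ n →
  trans (cong (a *_) (recurrence rec n)) (ℤ.*-distribˡ-+ a (f (n + + 1)) (f n))

fibonacciLike-+ : ∀ {f g} → FibonacciLike f → FibonacciLike g → FibonacciLike (λ n → f n + g n)
fibonacciLike-+ {f} {g} recf recg = fibonacciLike λ n →
  trans (cong₂ _+_ (recurrence recf n) (recurrence recg n)) (lemma (f (n + + 1)) (f n) (g (n + + 1)) (g n))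
  where
  lemma : ∀ a b c d → a + b + (c + d) ≡ a + c + (b + d)
  lemma = solve-∀

fibonacciLike-- : ∀ {f g} → FibonacciLike f → FibonacciLike g → FibonacciLike (λ n → f n - g n)
fibonacciLike-- {f} {g} recf recg = fibonacciLike λ n →
  trans (cong₂ _-_ (recurrence recf n) (recurrence recg n)) (lemma (f (n + + 1)) (f n) (g (n + + 1)) (g n))
  where
  lemma : ∀ a b c d → a + b - (c + d) ≡ a - c + (b - d)
  lemma = solve-∀

fibonacciLike-unique : ∀ {f g} → FibonacciLike f → FibonacciLike g →
                       f (+ 0) ≡ g (+ 0) → f (+ 1) ≡ g (+ 1) → ∀ n → f n ≡ g n
fibonacciLike-unique {f} {g} recf recg f₀≡g₀ f₁≡g₁ = agree
  where
  open ≡-Reasoning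
  Agree : ℤ → Set
  Agree n = f n ≡ g n × f (n + + 1) ≡ g (n + + 1)

  step-index : ∀ n → n + + 1 + + 1 ≡ n + + 2
  step-index n = ℤ.+-assoc n (+ 1) (+ 1)

  forward : ∀ n → Agree n → Agree (n + + 1)
  forward n (fₙ≡gₙ , fₙ₊₁≡gₙ₊₁) = fₙ₊₁≡gₙ₊₁ , (begin
    f (n + + 1 + + 1)  ≡⟨ cong f (step-index n) ⟩
    f (n + + 2)        ≡⟨ recurrence recf n ⟩
    f (n + + 1) + f n  ≡⟨ cong₂ _+_ fₙ₊₁≡gₙ₊₁ fₙ≡gₙ ⟩
    g (n + + 1) + g n  ≡⟨ recurrence recg n ⟨
    g (n + + 2)        ≡⟨ cong g (step-index n) ⟨
    g (n + + 1 + + 1)  ∎)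

  backward : ∀ n → Agree (n + + 1) → Agree n
  backward n (fₙ₊₁≡gₙ₊₁ , fₙ₊₂≡gₙ₊₂) = (begin
    f n                          ≡⟨ solve-back (recurrence recf n) ⟩
    f (n + + 2) - f (n + + 1)    ≡⟨ cong₂ _-_ fₙ₊₂≡gₙ₊₂′ fₙ₊₁≡gₙ₊₁ ⟩
    g (n + + 2) - g (n + + 1)    ≡⟨ solve-back (recurrence recg n) ⟨
    g n                          ∎) , fₙ₊₁≡gₙ₊₁
    where
    fₙ₊₂≡gₙ₊₂′ : f (n + + 2) ≡ g (n + + 2)
    fₙ₊₂≡gₙ₊₂′ = trans (cong f (sym (step-index n))) (trans fₙ₊₂≡gₙ₊₂ (cong g (step-index n)))
    solve-back : ∀ {a b c} → a ≡ b + c → c ≡ a - b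
    solve-back {a} {b} {c} refl = lemma b c
      where
      lemma : ∀ b c → c ≡ b + c - b
      lemma = solve-∀

  up : ∀ k → Agree (+ k)
  up zero    = f₀≡g₀ , f₁≡g₁
  up (suc k) = subst Agree (cong +_ (ℕ.+-comm k 1)) (forward (+ k) (up k))

  down : ∀ k → Agree (- + k)
  down zero    = f₀≡g₀ , f₁≡g₁
  down (suc k) = backward (- + suc k) (subst Agree (sym (predecessor k)) (down k))
    where
    predecessor : ∀ k → - + suc k + + 1 ≡ - + k
    predecessor zero    = refl
    predecessor (suc k) = refl

  agree : ∀ n → f n ≡ g n
  agree (+ k)    = proj₁ (up k)
  agree -[1+ k ] = proj₁ (down (suc k))

fibonacciLike-expansion : ∀ {f} → FibonacciLike f → ∀ n → f n ≡ f (+ 1) * F n + f (+ 0) * F (n - + 1)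
fibonacciLike-expansion {f} rec = fibonacciLike-unique rec
  (fibonacciLike-+ (fibonacciLike-* (f (+ 1)) F-fibonacciLike)
                   (fibonacciLike-* (f (+ 0)) (fibonacciLike-shift (- + 1) F-fibonacciLike)))
  (sym (at-0 (f (+ 1)) (f (+ 0))))
  (sym (at-1 (f (+ 1)) (f (+ 0))))
  where
  at-0 : ∀ a b → a * + 0 + b * + 1 ≡ b
  at-0 = solve-∀
  at-1 : ∀ a b → a * + 1 + b * + 0 ≡ a
  at-1 = solve-∀

F[a+b]≡F[a+1]F[b]+F[a]F[b-1] : ∀ a b → F (a + b) ≡ F (a + + 1) * F b + F a * F (b - + 1)
F[a+b]≡F[a+1]F[b]+F[a]F[b-1] a b = begin
  F (a + b)
    ≡⟨ cong F (ℤ.+-comm a b) ⟩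
  F (b + a)
    ≡⟨ fibonacciLike-expansion (fibonacciLike-shift a F-fibonacciLike) b ⟩
  F (+ 1 + a) * F b + F (+ 0 + a) * F (b - + 1)
    ≡⟨ cong₂ (λ i j → F i * F b + F j * F (b - + 1)) (ℤ.+-comm (+ 1) a) (ℤ.+-identityˡ a) ⟩
  F (a + + 1) * F b + F a * F (b - + 1) ∎
  where open ≡-Reasoning

H-fibonacciLike : ∀ k → FibonacciLike (λ r → H r k)
H-fibonacciLike k = fibonacciLike--
  (fibonacciLike-* (F (k + + 1)) (fibonacciLike-shift (- k) (fibonacciLike-shift (+ 2) F-fibonacciLike)))
  (fibonacciLike-* (F k) (fibonacciLike-shift (- k) (fibonacciLike-shift (+ 1) F-fibonacciLike)))

H≡F[r+2]-2F[k]F[r-k+1] : ∀ r k → H r k ≡ F (r + + 2) - + 2 * F k * F (r - k + + 1)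
H≡F[r+2]-2F[k]F[r-k+1] r k = begin
  A - B * C                             ≡⟨ lemma A B C ⟨
  A + B * C - + 2 * B * C               ≡⟨ cong (λ x → x - + 2 * B * C) (sym F[r+2]) ⟩
  F (r + + 2) - + 2 * B * C             ∎
  where
  open ≡-Reasoning
  A = F (k + + 1) * F (r - k + + 2)
  B = F k
  C = F (r - k + + 1)
  lemma : ∀ a b c → a + b * c - + 2 * b * c ≡ a - b * c
  lemma = solve-∀
  index₁ : ∀ r k → k + (r - k + + 2) ≡ r + + 2
  index₁ = solve-∀
  index₂ : ∀ r k → r - k + + 2 - + 1 ≡ r - k + + 1
  index₂ = solve-∀
  F[r+2] : F (r + + 2) ≡ A + B * C
  F[r+2] = trans (cong F (sym (index₁ r k)))
                 (trans (F[a+b]≡F[a+1]F[b]+F[a]F[b-1] k (r - k + + 2)) (cong (λ i → A + B * F i) (index₂ r k)))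

H[2k,k]≡F[k+1]² : ∀ k → H (k + k) k ≡ F (k + + 1) * F (k + + 1)
H[2k,k]≡F[k+1]² k = begin
  F (k + + 1) * F (k + k - k + + 2) - F k * F (k + k - k + + 1)
    ≡⟨ cong₂ (λ i j → F (k + + 1) * F i - F k * F j) (index (+ 2) k) (index (+ 1) k) ⟩
  F (k + + 1) * F (k + + 2) - F k * F (k + + 1)
    ≡⟨ cong (λ v → F (k + + 1) * v - F k * F (k + + 1)) (F-recurrence k) ⟩
  F (k + + 1) * (F (k + + 1) + F k) - F k * F (k + + 1)
    ≡⟨ lemma (F (k + + 1)) (F k) ⟩
  F (k + + 1) * F (k + + 1) ∎
  where
  open ≡-Reasoning
  index : ∀ c k → k + k - k + c ≡ k + c
  index = solve-∀
  lemma : ∀ a b → a * (a + b) - b * a ≡ a * a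
  lemma = solve-∀

sgn[n+n]≡1 : ∀ n → sgn (n ℕ.+ n) ≡ + 1
sgn[n+n]≡1 zero    = refl
sgn[n+n]≡1 (suc n) =
  trans (cong sgn (ℕ.+-suc (suc n) n)) (trans (ℤ.neg-involutive (sgn (n ℕ.+ n))) (sgn[n+n]≡1 n))

F[-n]≡sgn[n+1]F[n] : ∀ n → F (- + n) ≡ sgn (suc n) * F (+ n)
F[-n]≡sgn[n+1]F[n] zero    = refl
F[-n]≡sgn[n+1]F[n] (suc n) = cong (_* + fibℕ (suc n)) (sym (ℤ.neg-involutive (sgn n)))

cassini : ∀ n → F (+ suc (suc n)) * F (+ n) - F (+ suc n) * F (+ suc n) ≡ sgn (suc n)
cassini zero    = refl
cassini (suc n) = trans (lemma (+ fibℕ (suc n)) (+ fibℕ n)) (cong -_ (cassini n))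
  where
  lemma : ∀ a b → (a + b + a) * a - (a + b) * (a + b) ≡ - ((a + b) * b - a * a)
  lemma = solve-∀

H[4j,2j]≡F[2j+1]² : ∀ j → H (+ 4 * j) (+ 2 * j) ≡ F (+ 2 * j + + 1) * F (+ 2 * j + + 1)
H[4j,2j]≡F[2j+1]² j = trans (cong (λ r → H r (+ 2 * j)) (index j)) (H[2k,k]≡F[k+1]² (+ 2 * j))
  where
  index : ∀ j → + 4 * j ≡ + 2 * j + + 2 * j
  index = solve-∀

H[1,2t]≡2F[2t-1]² : ∀ s → H (+ 1) (+ 2 * + suc s) ≡ + 2 * (F (+ 2 * + suc s - + 1) * F (+ 2 * + suc s - + 1))
H[1,2t]≡2F[2t-1]² s = begin
  H (+ 1) (+ 2 * + suc s)
    ≡⟨ H≡F[r+2]-2F[k]F[r-k+1] (+ 1) (+ 2 * + suc s) ⟩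
  + 2 - + 2 * F (+ 2 * + suc s) * F (+ 1 - + 2 * + suc s + + 1)
    ≡⟨ cong₂ (λ i j → + 2 - + 2 * F i * F j) (index₁ (+ s)) (index₂ (+ s)) ⟩
  + 2 - + 2 * a * F (- + e)
    ≡⟨ cong (λ v → + 2 - + 2 * a * v) (trans (F[-n]≡sgn[n+1]F[n] e) (cong (λ σ → - σ * b) (sgn[n+n]≡1 s))) ⟩
  + 2 - + 2 * a * (- + 1 * b)
    ≡⟨ lemma a b c ⟩
  + 2 * (c * c) + + 2 * (a * b - c * c + + 1)
    ≡⟨ cong (λ d → + 2 * (c * c) + + 2 * (d + + 1)) (trans (cassini e) (cong -_ (sgn[n+n]≡1 s))) ⟩
  + 2 * (c * c) + + 0
    ≡⟨ ℤ.+-identityʳ _ ⟩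
  + 2 * (c * c)
    ≡⟨ cong (λ i → + 2 * (F i * F i)) (index₃ (+ s)) ⟨
  + 2 * (F (+ 2 * + suc s - + 1) * F (+ 2 * + suc s - + 1)) ∎
  where
  open ≡-Reasoning
  e = s ℕ.+ s
  a = F (+ suc (suc e))
  b = F (+ e)
  c = F (+ suc e)
  index₁ : ∀ x → + 2 * (+ 1 + x) ≡ + 1 + (+ 1 + (x + x))
  index₁ = solve-∀
  index₂ : ∀ x → + 1 - + 2 * (+ 1 + x) + + 1 ≡ - (x + x)
  index₂ = solve-∀
  index₃ : ∀ x → + 2 * (+ 1 + x) - + 1 ≡ + 1 + (x + x)
  index₃ = solve-∀
  lemma : ∀ a b c → + 2 - + 2 * a * (- + 1 * b) ≡ + 2 * (c * c) + + 2 * (a * b - c * c + + 1)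
  lemma = solve-∀

-H[-1,2t+1]≡2F[2t+1]²-1 : ∀ t →
  - H (- + 1) (+ 2 * + t + + 1) ≡ + 2 * (F (+ 2 * + t + + 1) * F (+ 2 * + t + + 1)) - + 1
-H[-1,2t+1]≡2F[2t+1]²-1 t = begin
  - H (- + 1) k                              ≡⟨ cong -_ (H≡F[r+2]-2F[k]F[r-k+1] (- + 1) k) ⟩
  - (+ 1 - + 2 * F k * F (- + 1 - k + + 1))  ≡⟨ cong (λ v → - (+ 1 - + 2 * F k * v)) F[1-k-1]≡F[k] ⟩
  - (+ 1 - + 2 * F k * F k)                  ≡⟨ lemma (F k) ⟩
  + 2 * (F k * F k) - + 1                    ∎
  where
  open ≡-Reasoning
  k = + 2 * + t + + 1
  e = t ℕ.+ t
  index₁ : ∀ x → - + 1 - (+ 2 * x + + 1) + + 1 ≡ - (+ 1 + (x + x))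
  index₁ = solve-∀
  index₂ : ∀ x → + 2 * x + + 1 ≡ + 1 + (x + x)
  index₂ = solve-∀
  lemma : ∀ a → - (+ 1 - + 2 * a * a) ≡ + 2 * (a * a) - + 1
  lemma = solve-∀
  sgn[2+e]≡1 : sgn (suc (suc e)) ≡ + 1
  sgn[2+e]≡1 = trans (ℤ.neg-involutive (sgn e)) (sgn[n+n]≡1 t)
  F[1-k-1]≡F[k] : F (- + 1 - k + + 1) ≡ F k
  F[1-k-1]≡F[k] = begin
    F (- + 1 - k + + 1)               ≡⟨ cong F (index₁ (+ t)) ⟩
    F (- + suc e)                     ≡⟨ F[-n]≡sgn[n+1]F[n] (suc e) ⟩
    sgn (suc (suc e)) * F (+ suc e)   ≡⟨ cong (_* F (+ suc e)) sgn[2+e]≡1 ⟩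
    + 1 * F (+ suc e)                 ≡⟨ ℤ.*-identityˡ _ ⟩
    F (+ suc e)                       ≡⟨ cong F (index₂ (+ t)) ⟨
    F k                               ∎

2H[4t-4,2t-2]≡2F[2t-1]² : ∀ t →
  + 2 * H (+ 4 * (+ t - + 1)) (+ 2 * (+ t - + 1)) ≡ + 2 * (F (+ 2 * + t - + 1) * F (+ 2 * + t - + 1))
2H[4t-4,2t-2]≡2F[2t-1]² t =
  cong (+ 2 *_) (trans (H[4j,2j]≡F[2j+1]² (+ t - + 1)) (cong (λ i → F i * F i) (index (+ t))))
  where
  index : ∀ x → + 2 * (x - + 1) + + 1 ≡ + 2 * x - + 1
  index = solve-∀

2H[4t,2t]-1≡2F[2t+1]²-1 : ∀ t →
  + 2 * H (+ 4 * + t) (+ 2 * + t) - + 1 ≡ + 2 * (F (+ 2 * + t + + 1) * F (+ 2 * + t + + 1)) - + 1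
2H[4t,2t]-1≡2F[2t+1]²-1 t = cong (λ h → + 2 * h - + 1) (H[4j,2j]≡F[2j+1]² (+ t))

fibonacciLike-mod-period : ∀ {f m} → FibonacciLike f → ∀ n →
                           F (n - + 1) ≡ + 0 [mod m ] → F n ≡ + 1 [mod m ] → f n ≡ f (+ 1) [mod m ]
fibonacciLike-mod-period {f} rec n F[n-1]≡0 F[n]≡1 =
  mod-trans (≡⇒≡-mod (fibonacciLike-expansion rec n))
    (mod-trans (+-cong-mod (*-cong-mod (mod-refl {a = f (+ 1)}) F[n]≡1)
                           (*-cong-mod (mod-refl {a = f (+ 0)}) F[n-1]≡0))
      (≡⇒≡-mod (lemma (f (+ 1)) (f (+ 0)))))
  where
  lemma : ∀ a b → a * + 1 + b * + 0 ≡ a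
  lemma = solve-∀

-- Here F (n + 1) ≡ 0, so shifting by n + 1 negates every Fibonacci-like sequence modulo m.
fibonacciLike-mod-antiperiod : ∀ {f m} → FibonacciLike f → ∀ n →
                               F (n - + 1) ≡ + 1 [mod m ] → F n ≡ - + 1 [mod m ] → f n ≡ - f (- + 1) [mod m ]
fibonacciLike-mod-antiperiod {f} rec n F[n-1]≡1 F[n]≡-1 =
  mod-trans (≡⇒≡-mod (fibonacciLike-expansion rec n))
    (mod-trans (+-cong-mod (*-cong-mod (mod-refl {a = f (+ 1)}) F[n]≡-1)
                           (*-cong-mod (mod-refl {a = f (+ 0)}) F[n-1]≡1))
      (≡⇒≡-mod (combine {f (+ 1)} {f (+ 0)} {f (- + 1)} (recurrence rec (- + 1)))))
  where
  combine : ∀ {a b c} → a ≡ b + c → a * - + 1 + b * + 1 ≡ - c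
  combine {b = b} {c} refl = lemma b c
    where
    lemma : ∀ b c → (b + c) * - + 1 + b * + 1 ≡ - c
    lemma = solve-∀

-- The group ring ℤ[C₅]

-- x stands for Σᵢ xᵢ Xⁱ in ℤ[X]/(X⁵ - 1); rot below is multiplication by X.
ℤ[C₅] : Set
ℤ[C₅] = Fin 5 → ℤ

Σ₅ : (Fin 5 → ℤ) → ℤ
Σ₅ f = f 0F + f 1F + f 2F + f 3F + f 4F

Σ₅-cong : ∀ {f g} → (∀ k → f k ≡ g k) → Σ₅ f ≡ Σ₅ g
Σ₅-cong f≡g = cong₂ _+_ (cong₂ _+_ (cong₂ _+_ (cong₂ _+_ (f≡g 0F) (f≡g 1F)) (f≡g 2F)) (f≡g 3F)) (f≡g 4F)

Σ₅-cong-mod : ∀ {f g m} → (∀ k → f k ≡ g k [mod m ]) → Σ₅ f ≡ Σ₅ g [mod m ]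
Σ₅-cong-mod f≡g = +-cong-mod (+-cong-mod (+-cong-mod (+-cong-mod (f≡g 0F) (f≡g 1F)) (f≡g 2F)) (f≡g 3F)) (f≡g 4F)

Σ₅-+ : ∀ f g → Σ₅ (λ k → f k + g k) ≡ Σ₅ f + Σ₅ g
Σ₅-+ f g = lemma (f 0F) (f 1F) (f 2F) (f 3F) (f 4F) (g 0F) (g 1F) (g 2F) (g 3F) (g 4F)
  where
  lemma : ∀ a b c d e a′ b′ c′ d′ e′ →
    (a + a′) + (b + b′) + (c + c′) + (d + d′) + (e + e′) ≡ (a + b + c + d + e) + (a′ + b′ + c′ + d′ + e′)
  lemma = solve-∀

Σ₅-*ˡ : ∀ a f → Σ₅ (λ k → a * f k) ≡ a * Σ₅ f
Σ₅-*ˡ a f = lemma a (f 0F) (f 1F) (f 2F) (f 3F) (f 4F)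
  where
  lemma : ∀ x a b c d e → x * a + x * b + x * c + x * d + x * e ≡ x * (a + b + c + d + e)
  lemma = solve-∀

Σ₅-*ʳ : ∀ f a → Σ₅ (λ k → f k * a) ≡ Σ₅ f * a
Σ₅-*ʳ f a = trans (Σ₅-cong (λ k → ℤ.*-comm (f k) a)) (trans (Σ₅-*ˡ a f) (ℤ.*-comm a (Σ₅ f)))

Σ₅-swap : ∀ (f : Fin 5 → Fin 5 → ℤ) → Σ₅ (λ j → Σ₅ (λ k → f j k)) ≡ Σ₅ (λ k → Σ₅ (λ j → f j k))
Σ₅-swap f = sym (begin
  Σ₅ (λ k → f 0F k + f 1F k + f 2F k + f 3F k + f 4F k)
    ≡⟨ Σ₅-+ (λ k → f 0F k + f 1F k + f 2F k + f 3F k) (f 4F) ⟩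
  Σ₅ (λ k → f 0F k + f 1F k + f 2F k + f 3F k) + Σ₅ (f 4F)
    ≡⟨ cong (_+ Σ₅ (f 4F)) (Σ₅-+ (λ k → f 0F k + f 1F k + f 2F k) (f 3F)) ⟩
  Σ₅ (λ k → f 0F k + f 1F k + f 2F k) + Σ₅ (f 3F) + Σ₅ (f 4F)
    ≡⟨ cong (λ s → s + Σ₅ (f 3F) + Σ₅ (f 4F)) (Σ₅-+ (λ k → f 0F k + f 1F k) (f 2F)) ⟩
  Σ₅ (λ k → f 0F k + f 1F k) + Σ₅ (f 2F) + Σ₅ (f 3F) + Σ₅ (f 4F)
    ≡⟨ cong (λ s → s + Σ₅ (f 2F) + Σ₅ (f 3F) + Σ₅ (f 4F)) (Σ₅-+ (f 0F) (f 1F)) ⟩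
  Σ₅ (f 0F) + Σ₅ (f 1F) + Σ₅ (f 2F) + Σ₅ (f 3F) + Σ₅ (f 4F) ∎)
  where open ≡-Reasoning

pred₅ : Fin 5 → Fin 5
pred₅ zero    = 4F
pred₅ (suc i) = inject₁ i

pred₅-period : ∀ i → pred₅ (pred₅ (pred₅ (pred₅ (pred₅ i)))) ≡ i
pred₅-period 0F = refl
pred₅-period 1F = refl
pred₅-period 2F = refl
pred₅-period 3F = refl
pred₅-period 4F = refl

Σ₅-∘pred₅ : ∀ f → Σ₅ (f ∘ pred₅) ≡ Σ₅ f
Σ₅-∘pred₅ f = lemma (f 0F) (f 1F) (f 2F) (f 3F) (f 4F)
  where
  lemma : ∀ a b c d e → e + a + b + c + d ≡ a + b + c + d + e
  lemma = solve-∀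

Σ₅-reflect : ∀ f → Σ₅ f ≡ f 0F + f 4F + f 3F + f 2F + f 1F
Σ₅-reflect f = lemma (f 0F) (f 1F) (f 2F) (f 3F) (f 4F)
  where
  lemma : ∀ a b c d e → a + b + c + d + e ≡ a + e + d + c + b
  lemma = solve-∀

infixl 6 _⊕_
infixl 7 _⊛_

_⊕_ : ℤ[C₅] → ℤ[C₅] → ℤ[C₅]
(x ⊕ y) i = x i + y i

rot : ℤ[C₅] → ℤ[C₅]
rot x = x ∘ pred₅

rot^ : ℕ → ℤ[C₅] → ℤ[C₅]
rot^ zero    x = x
rot^ (suc n) x = rot (rot^ n x)

_⊛_ : ℤ[C₅] → ℤ[C₅] → ℤ[C₅]
(x ⊛ y) i = Σ₅ (λ k → x k * rot^ (toℕ k) y i)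

𝟘 𝟙 : ℤ[C₅]
𝟘 _  = + 0
𝟙 0F = + 1
𝟙 _  = + 0

rot⁵ : ∀ x → rot^ 5 x ≗ x
rot⁵ x i = cong x (pred₅-period i)

⊛-rot^ : ∀ n x y → x ⊛ rot^ n y ≗ rot^ n (x ⊛ y)
⊛-rot^ zero    x y i = refl
⊛-rot^ (suc n) x y i = ⊛-rot^ n x y (pred₅ i)

rot-⊛ : ∀ x y → rot x ⊛ y ≗ rot (x ⊛ y)
rot-⊛ x y i = trans (Σ₅-cong {f = term} {g = shifted ∘ pred₅} agree) (Σ₅-∘pred₅ shifted)
  where
  term shifted : Fin 5 → ℤ
  term k = x (pred₅ k) * rot^ (toℕ k) y i
  shifted k = x k * rot^ (suc (toℕ k)) y i
  agree : ∀ k → term k ≡ shifted (pred₅ k)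
  agree 0F = cong (x 4F *_) (sym (rot⁵ y i))
  agree 1F = refl
  agree 2F = refl
  agree 3F = refl
  agree 4F = refl

rot^-⊛ : ∀ n x y → rot^ n x ⊛ y ≗ rot^ n (x ⊛ y)
rot^-⊛ zero    x y i = refl
rot^-⊛ (suc n) x y i = trans (rot-⊛ (rot^ n x) y i) (rot^-⊛ n x y (pred₅ i))

⊛-comm-at-0 : ∀ x y → (x ⊛ y) 0F ≡ (y ⊛ x) 0F
⊛-comm-at-0 x y =
  trans (Σ₅-reflect (λ k → x k * rot^ (toℕ k) y 0F)) (Σ₅-cong (λ k → ℤ.*-comm (x (neg₅ k)) (y k)))
  where
  neg₅ : Fin 5 → Fin 5
  neg₅ 0F = 0F
  neg₅ 1F = 4F
  neg₅ 2F = 3F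
  neg₅ 3F = 2F
  neg₅ 4F = 1F

⊛-comm-rot^ : ∀ n x y → rot^ n (x ⊛ y) 0F ≡ rot^ n (y ⊛ x) 0F
⊛-comm-rot^ n x y = trans (sym (rot^-⊛ n x y 0F)) (trans (⊛-comm-at-0 (rot^ n x) y) (⊛-rot^ n y x 0F))

-- Component i of x ⊛ y is component 0 of rot^ (5 - i) (x ⊛ y).
⊛-comm : ∀ x y → x ⊛ y ≗ y ⊛ x
⊛-comm x y 0F = ⊛-comm-rot^ 0 x y
⊛-comm x y 1F = ⊛-comm-rot^ 4 x y
⊛-comm x y 2F = ⊛-comm-rot^ 3 x y
⊛-comm x y 3F = ⊛-comm-rot^ 2 x y
⊛-comm x y 4F = ⊛-comm-rot^ 1 x y

⊛-assoc : ∀ x y z → (x ⊛ y) ⊛ z ≗ x ⊛ (y ⊛ z)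
⊛-assoc x y z i = begin
  Σ₅ (λ j → Σ₅ (λ k → x k * b k j) * c j)     ≡⟨ Σ₅-cong (λ j → sym (Σ₅-*ʳ (λ k → x k * b k j) (c j))) ⟩
  Σ₅ (λ j → Σ₅ (λ k → x k * b k j * c j))     ≡⟨ Σ₅-cong (λ j → Σ₅-cong (λ k → ℤ.*-assoc (x k) (b k j) (c j))) ⟩
  Σ₅ (λ j → Σ₅ (λ k → x k * (b k j * c j)))   ≡⟨ Σ₅-swap (λ j k → x k * (b k j * c j)) ⟩
  Σ₅ (λ k → Σ₅ (λ j → x k * (b k j * c j)))   ≡⟨ Σ₅-cong (λ k → Σ₅-*ˡ (x k) (λ j → b k j * c j)) ⟩
  Σ₅ (λ k → x k * (rot^ (toℕ k) y ⊛ z) i)     ≡⟨ Σ₅-cong (λ k → cong (x k *_) (rot^-⊛ (toℕ k) y z i)) ⟩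
  Σ₅ (λ k → x k * rot^ (toℕ k) (y ⊛ z) i)     ∎
  where
  open ≡-Reasoning
  b : Fin 5 → Fin 5 → ℤ
  b k j = rot^ (toℕ k) y j
  c : Fin 5 → ℤ
  c j = rot^ (toℕ j) z i

⊛-distribʳ : ∀ x y z → (x ⊕ y) ⊛ z ≗ x ⊛ z ⊕ y ⊛ z
⊛-distribʳ x y z i = trans (Σ₅-cong (λ k → ℤ.*-distribʳ-+ (rot^ (toℕ k) z i) (x k) (y k)))
                           (Σ₅-+ (λ k → x k * rot^ (toℕ k) z i) (λ k → y k * rot^ (toℕ k) z i))

⊛-identityˡ : ∀ x → 𝟙 ⊛ x ≗ x
⊛-identityˡ x i = lemma (x i)
  where
  lemma : ∀ a → + 1 * a + + 0 + + 0 + + 0 + + 0 ≡ a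
  lemma = solve-∀

⊛-zeroˡ : ∀ x → 𝟘 ⊛ x ≗ 𝟘
⊛-zeroˡ x i = refl

infix 4 _≋_[mod_]

_≋_[mod_] : ℤ[C₅] → ℤ[C₅] → ℤ → Set
x ≋ y [mod m ] = ∀ i → x i ≡ y i [mod m ]

rot^-cong : ∀ n {x y m} → x ≋ y [mod m ] → rot^ n x ≋ rot^ n y [mod m ]
rot^-cong zero    x≋y = x≋y
rot^-cong (suc n) x≋y = rot^-cong n x≋y ∘ pred₅

ℤ[C₅]-mod : ℤ → CommutativeSemiring 0ℓ 0ℓ
ℤ[C₅]-mod m = record
  { _≈_ = _≋_[mod m ] ; _+_ = _⊕_ ; _*_ = _⊛_ ; 0# = 𝟘 ; 1# = 𝟙
  ; isCommutativeSemiring = isCommutativeSemiringˡ record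
  { +-isCommutativeMonoid = isCommutativeMonoidˡ record
    { isSemigroup = record
      { isMagma = record { isEquivalence = ≋-isEquivalence ; ∙-cong = ⊕-cong }
      ; assoc = λ x y z i → ≡⇒≡-mod (ℤ.+-assoc (x i) (y i) (z i))
      }
    ; identityˡ = λ x i → ≡⇒≡-mod (ℤ.+-identityˡ (x i))
    ; comm = λ x y i → ≡⇒≡-mod (ℤ.+-comm (x i) (y i))
    }
  ; *-isCommutativeMonoid = isCommutativeMonoidˡ record
    { isSemigroup = record
      { isMagma = record { isEquivalence = ≋-isEquivalence ; ∙-cong = ⊛-cong }
      ; assoc = λ x y z → exact (⊛-assoc x y z)
      }
    ; identityˡ = λ x → exact (⊛-identityˡ x)
    ; comm = λ x y → exact (⊛-comm x y)
    }
  ; distribʳ = λ x y z → exact (⊛-distribʳ y z x)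
  ; zeroˡ = λ x → exact (⊛-zeroˡ x)
  } }
  where
  open import Algebra.Structures.Biased (_≋_[mod m ])
  exact : ∀ {x y} → x ≗ y → x ≋ y [mod m ]
  exact x≗y i = ≡⇒≡-mod (x≗y i)
  ≋-isEquivalence : IsEquivalence (_≋_[mod m ])
  ≋-isEquivalence = record
    { refl  = λ i → mod-refl
    ; sym   = λ x≋y i → mod-sym (x≋y i)
    ; trans = λ x≋y y≋z i → mod-trans (x≋y i) (y≋z i)
    }
  ⊕-cong : ∀ {x x′ y y′} → x ≋ x′ [mod m ] → y ≋ y′ [mod m ] → x ⊕ y ≋ x′ ⊕ y′ [mod m ]
  ⊕-cong x≋x′ y≋y′ i = +-cong-mod (x≋x′ i) (y≋y′ i)
  ⊛-cong : ∀ {x x′ y y′} → x ≋ x′ [mod m ] → y ≋ y′ [mod m ] → x ⊛ y ≋ x′ ⊛ y′ [mod m ]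
  ⊛-cong x≋x′ y≋y′ i = Σ₅-cong-mod (λ k → *-cong-mod (x≋x′ k) (rot^-cong (toℕ k) y≋y′ i))

ℤ[C₅]-mod-characteristic : ∀ p → Frobenius.HasCharacteristic (ℤ[C₅]-mod (+ p)) p
ℤ[C₅]-mod-characteristic p x i =
  mod-trans (≡⇒≡-mod (×ₙ-pointwise p i)) (∣⇒≡0-mod (ℤˢ.∣m⇒∣m*n (x i) ℤˢ.∣-refl))
  where
  open Frobenius (ℤ[C₅]-mod (+ p)) using (_×ₙ_)
  ×ₙ-pointwise : ∀ n i → (n ×ₙ x) i ≡ + n * x i
  ×ₙ-pointwise zero    i = refl
  ×ₙ-pointwise (suc n) i = trans (cong (_+_ (x i)) (×ₙ-pointwise n i)) (lemma (x i) (+ n))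
    where
    lemma : ∀ a k → a + k * a ≡ (+ 1 + k) * a
    lemma = solve-∀

-- Fibonacci numbers modulo a prime

X X⁴ φ : ℤ[C₅]
X 1F = + 1
X _  = + 0
X⁴ 4F = + 1
X⁴ _  = + 0
φ = 𝟙 ⊕ X ⊕ X⁴

-- golden A B c = A φ + B + c N.
golden : ℤ → ℤ → ℤ → ℤ[C₅]
golden A B c 0F = A + B + c
golden A B c 1F = A + c
golden A B c 2F = c
golden A B c 3F = c
golden A B c 4F = A + c

φ-⊛ : ∀ x i → (φ ⊛ x) i ≡ x i + rot x i + rot^ 4 x i
φ-⊛ x i = lemma (x i) (rot x i) (rot^ 4 x i)
  where
  lemma : ∀ a b c → + 1 * a + + 1 * b + + 0 + + 0 + + 1 * c ≡ a + b + c
  lemma = solve-∀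

φ-⊛-golden : ∀ A B c → φ ⊛ golden A B c ≗ golden (A + B) A (A + + 3 * c)
φ-⊛-golden A B c i = trans (φ-⊛ (golden A B c) i) (at i)
  where
  at : ∀ i → golden A B c i + golden A B c (pred₅ i) + rot^ 4 (golden A B c) i
           ≡ golden (A + B) A (A + + 3 * c) i
  at 0F = lemma A B c
    where
    lemma : ∀ A B c → A + B + c + (A + c) + (A + c) ≡ A + B + A + (A + + 3 * c)
    lemma = solve-∀
  at 1F = lemma A B c
    where
    lemma : ∀ A B c → A + c + (A + B + c) + c ≡ A + B + (A + + 3 * c)
    lemma = solve-∀
  at 2F = lemma A c
    where
    lemma : ∀ A c → c + (A + c) + c ≡ A + + 3 * c
    lemma = solve-∀
  at 3F = lemma A c
    where
    lemma : ∀ A c → c + c + (A + c) ≡ A + + 3 * c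
    lemma = solve-∀
  at 4F = lemma A B c
    where
    lemma : ∀ A B c → A + c + c + (A + B + c) ≡ A + B + (A + + 3 * c)
    lemma = solve-∀

golden-coefficients : ∀ {A B c m x} → golden A B c ≋ x [mod m ] →
                      A ≡ x 1F - x 2F [mod m ] × B ≡ x 0F - x 1F [mod m ]
golden-coefficients {A} {B} {c} g≋x =
  mod-trans (≡⇒≡-mod (sym (lemma₁ A c))) (+-cong-mod (g≋x 1F) (-‿cong-mod (g≋x 2F))) ,
  mod-trans (≡⇒≡-mod (sym (lemma₀ A B c))) (+-cong-mod (g≋x 0F) (-‿cong-mod (g≋x 1F)))
  where
  lemma₁ : ∀ A c → A + c - c ≡ A
  lemma₁ = solve-∀
  lemma₀ : ∀ A B c → A + B + c - (A + c) ≡ B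
  lemma₀ = solve-∀

module _ {m : ℤ} where
  open CommutativeSemiring (ℤ[C₅]-mod m) using (*-congˡ) renaming (trans to ≋-trans)
  open Frobenius (ℤ[C₅]-mod m) using (_^_)

  φ^-golden : ∀ n → ∃ λ c → φ ^ n ≋ golden (F (+ n)) (F (+ n - + 1)) c [mod m ]
  φ^-golden zero    = + 0 , λ { 0F → mod-refl ; 1F → mod-refl ; 2F → mod-refl ; 3F → mod-refl ; 4F → mod-refl }
  φ^-golden (suc n) with φ^-golden n
  ... | c , φ^n≋g = F (+ n) + + 3 * c , ≋-trans (*-congˡ {φ} φ^n≋g) (λ i → ≡⇒≡-mod (trans
    (φ-⊛-golden (F (+ n)) (F (+ n - + 1)) c i) (cong (λ A → golden A (F (+ n)) (F (+ n) + + 3 * c) i) F[n+1])))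
    where
    index₂ : ∀ x → x - + 1 + + 2 ≡ + 1 + x
    index₂ = solve-∀
    index₁ : ∀ x → x - + 1 + + 1 ≡ x
    index₁ = solve-∀
    F[n+1] : F (+ n) + F (+ n - + 1) ≡ F (+ suc n)
    F[n+1] = sym (trans (cong F (sym (index₂ (+ n))))
                        (trans (F-recurrence (+ n - + 1)) (cong (λ j → F j + F (+ n - + 1)) (index₁ (+ n)))))

module _ {p} (p-prime : Prime p) where
  open CommutativeSemiring (ℤ[C₅]-mod (+ p))
    using (+-cong; +-congʳ; setoid) renaming (sym to ≋-sym; trans to ≋-trans)
  open Frobenius (ℤ[C₅]-mod (+ p)) using (_^_; frobenius; ^-periodic; 1#^n≈1#)
  open import Relation.Binary.Reasoning.Setoid setoid

  φ^p : φ ^ p ≋ 𝟙 ⊕ X ^ (p % 5) ⊕ X⁴ ^ (p % 5) [mod + p ]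
  φ^p = begin
    (𝟙 ⊕ X ⊕ X⁴) ^ p                ≈⟨ frobenius p-prime (ℤ[C₅]-mod-characteristic p) (𝟙 ⊕ X) X⁴ ⟩
    (𝟙 ⊕ X) ^ p ⊕ X⁴ ^ p            ≈⟨ +-congʳ (frobenius p-prime (ℤ[C₅]-mod-characteristic p) 𝟙 X) ⟩
    𝟙 ^ p ⊕ X ^ p ⊕ X⁴ ^ p          ≈⟨ +-cong (+-cong (1#^n≈1# p) (^-periodic X^5≋𝟙 p)) (^-periodic X⁴^5≋𝟙 p) ⟩
    𝟙 ⊕ X ^ (p % 5) ⊕ X⁴ ^ (p % 5)  ∎
    where
    X^5≋𝟙 : X ^ 5 ≋ 𝟙 [mod + p ]
    X^5≋𝟙 = λ { 0F → mod-refl ; 1F → mod-refl ; 2F → mod-refl ; 3F → mod-refl ; 4F → mod-refl }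
    X⁴^5≋𝟙 : X⁴ ^ 5 ≋ 𝟙 [mod + p ]
    X⁴^5≋𝟙 = λ { 0F → mod-refl ; 1F → mod-refl ; 2F → mod-refl ; 3F → mod-refl ; 4F → mod-refl }

  fibonacci-mod-prime : ∀ {r} → p % 5 ≡ r → let x = 𝟙 ⊕ X ^ r ⊕ X⁴ ^ r in
                        F (+ p) ≡ x 1F - x 2F [mod + p ] × F (+ p - + 1) ≡ x 0F - x 1F [mod + p ]
  fibonacci-mod-prime refl = golden-coefficients (≋-trans (≋-sym (proj₂ (φ^-golden p))) φ^p)

  fibonacci-mod-prime-±1 : p % 5 ≡ 1 ⊎ p % 5 ≡ 4 → F (+ p) ≡ + 1 [mod + p ] × F (+ p - + 1) ≡ + 0 [mod + p ]
  fibonacci-mod-prime-±1 (inj₁ p%5≡1) = fibonacci-mod-prime p%5≡1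
  fibonacci-mod-prime-±1 (inj₂ p%5≡4) = fibonacci-mod-prime p%5≡4

  fibonacci-mod-prime-±2 : p % 5 ≡ 2 ⊎ p % 5 ≡ 3 → F (+ p) ≡ - + 1 [mod + p ] × F (+ p - + 1) ≡ + 1 [mod + p ]
  fibonacci-mod-prime-±2 (inj₁ p%5≡2) = fibonacci-mod-prime p%5≡2
  fibonacci-mod-prime-±2 (inj₂ p%5≡3) = fibonacci-mod-prime p%5≡3

theorem2p8 : (p t : ℕ) → Prime p → t ≥ 1 →
    (((p % 5 ≡ 1) ⊎ (p % 5 ≡ 4)) →
      (H (+ p) (+ 2 * + t) ≅ + 2 * H (+ 4 * (+ t - + 1)) (+ 2 * (+ t - + 1)) [mod + p ])
      × (+ 2 * H (+ 4 * (+ t - + 1)) (+ 2 * (+ t - + 1)) ≅ + 2 * (F (+ 2 * + t - + 1) * F (+ 2 * + t - + 1)) [mod + p ]))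
    × (((p % 5 ≡ 2) ⊎ (p % 5 ≡ 3)) →
      (H (+ p) (+ 2 * + t + + 1) ≅ + 2 * H (+ 4 * + t) (+ 2 * + t) - + 1 [mod + p ])
      × (+ 2 * H (+ 4 * + t) (+ 2 * + t) - + 1 ≅ + 2 * (F (+ 2 * + t + + 1) * F (+ 2 * + t + + 1)) - + 1 [mod + p ]))
theorem2p8 p t@(suc s) p-prime _ =
  (λ p%5≡±1 → let F[p] , F[p-1] = fibonacci-mod-prime-±1 p-prime p%5≡±1 in
    ≡-mod⇒≅ (mod-trans (fibonacciLike-mod-period (H-fibonacciLike (+ 2 * + t)) (+ p) F[p-1] F[p])
                       (≡⇒≡-mod (trans (H[1,2t]≡2F[2t-1]² s) (sym (2H[4t-4,2t-2]≡2F[2t-1]² t))))) ,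
    ≡-mod⇒≅ (≡⇒≡-mod {+ p} (2H[4t-4,2t-2]≡2F[2t-1]² t))) ,
  (λ p%5≡±2 → let F[p] , F[p-1] = fibonacci-mod-prime-±2 p-prime p%5≡±2 in
    ≡-mod⇒≅ (mod-trans (fibonacciLike-mod-antiperiod (H-fibonacciLike (+ 2 * + t + + 1)) (+ p) F[p-1] F[p])
                       (≡⇒≡-mod (trans (-H[-1,2t+1]≡2F[2t+1]²-1 t) (sym (2H[4t,2t]-1≡2F[2t+1]²-1 t))))) ,
    ≡-mod⇒≅ (≡⇒≡-mod {+ p} (2H[4t,2t]-1≡2F[2t+1]²-1 t)))
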